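{- Let $G=(V,E)$ be a finite strongly connected directed graph, $s\in V$, $d$ a positive integer, and $G^d$ the directed graph with vertex set $V$ in which each edge of $G$ is replaced by $d$ parallel copies. Then $B(G^d,s;y)=B(G,s;y^d)\cdot\left(\dfrac{1-y^d}{1-y}\right)^{|V|-1}$.
   Context: For a finite strongly connected directed graph $H$ on $V$ (loops, multiple edges allowed) with outdegrees $\deg^+_H$: the sandpile model with sink $s$ has $s$-configurations $\hat{\mathbf c}\in\mathbb N_0^{V\setminus\{s\}}$; firing $v\ne s$ removes $\deg^+_H(v)$ chips from $v$ and sends one chip along each outgoing edge to its target, chips sent to $s$ disappearing; legal if $\hat{\mathbf c}(v)\ge\deg^+_H(v)$; stable if $\hat{\mathbf c}(v)<\deg^+_H(v)$ for all $v\ne s$. Every $\hat{\mathbf c}$ reaches by legal firings a unique stable $\hat{\mathbf c}^\circ$. $\hat{\mathbf c}$ is $s$-recurrent if for every $\hat{\mathbf c}_1$ there is $\hat{\mathbf c}_2$ with $(\hat{\mathbf c}_1+\hat{\mathbf c}_2)^\circ=\hat{\mathbf c}$. $\mathbf u_s(v)$ is the number of edges from $s$ to $v$; on $s$-recurrent configurations, $\hat{\mathbf c}\overset{s}{\sim}\hat{\mathbf d}$ iff $\hat{\mathbf d}=(\hat{\mathbf c}+k\mathbf u_s)^\circ$ for some $k\in\mathbb N_0$ (an equivalence relation). The d-level is $\mathrm{dlvl}(\hat{\mathbf c})=\deg^+_H(s)+\sum_{v\ne s}\hat{\mathbf c}(v)$, the d-level of a class is the maximum over its elements, and the Biggs-Merino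 polynomial is $B(H,s;y)=\sum_{\text{classes }[\hat{\mathbf c}]}y^{\mathrm{dlvl}([\hat{\mathbf c}])}$. -}

module Defs where

open import Data.Nat using (ℕ; zero; suc; _+_; _*_; _∸_; _≤_; _<_)
open import Data.Nat.Properties using () renaming (_≟_ to _≟ℕ_)
open import Data.Fin using (Fin; zero; suc; toℕ)
open import Data.Fin.Properties using (_≟_)
open import Data.Bool using (if_then_else_)
open import Data.Product using (Σ; ∃; _×_; _,_)
open import Relation.Nullary using (¬_; does)
open import Relation.Binary.PropositionalEquality using (_≡_)
open import Relation.Binary.Construct.Closure.ReflexiveTransitive using (Star)

ΣF : ∀ {n} → (Fin n → ℕ) → ℕ
ΣF {zero}  f = 0
ΣF {suc n} f = f zero + ΣF (λ i → f (suc i))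

Σ≤ : ℕ → (ℕ → ℕ) → ℕ
Σ≤ zero    f = f 0
Σ≤ (suc k) f = Σ≤ k f + f (suc k)

-- Directed multigraphs on vertex set Fin n (loops and multiple edges
-- allowed): A u v = number of edges from u to v.

Adj : ℕ → Set
Adj n = Fin n → Fin n → ℕ

outdeg : ∀ {n} → Adj n → Fin n → ℕ
outdeg A u = ΣF (λ v → A u v)

Path : ∀ {n} → Adj n → Fin n → Fin n → Set
Path A = Star (λ a b → 0 < A a b)

StronglyConnected : ∀ {n} → Adj n → Set
StronglyConnected {n} A = (u v : Fin n) → Path A u v

power : ∀ {n} → ℕ → Adj n → Adj n
power d A u v = d * A u v

-- Sandpile model with sink s.
-- An s-configuration is represented by a function Fin n → ℕ whose value
-- at the sink is ignored: all notions below only look at v ≢ s.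

Config : ℕ → Set
Config n = Fin n → ℕ

module Sandpile {n : ℕ} (A : Adj n) (s : Fin n) where

  _≐_ : Config n → Config n → Set
  c ≐ d = (v : Fin n) → ¬ (v ≡ s) → c v ≡ d v

  _⊕_ : Config n → Config n → Config n
  (c ⊕ d) v = c v + d v

  fire : Fin n → Config n → Config n
  fire v c w = (if does (w ≟ v) then c w ∸ outdeg A v else c w) + A v w

  Step : Config n → Config n → Set
  Step c c' = Σ (Fin n) λ v → ¬ (v ≡ s) × outdeg A v ≤ c v × c' ≐ fire v c

  Stable : Config n → Set
  Stable c = (v : Fin n) → ¬ (v ≡ s) → c v < outdeg A v

  StabilizesTo : Config n → Config n → Set
  StabilizesTo c d = Σ (Config n) λ e → Star Step c e × e ≐ d × Stable d

  Recurrent : Config n → Set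
  Recurrent c = (c₁ : Config n) → ∃ λ c₂ → StabilizesTo (c₁ ⊕ c₂) c

  u : Config n
  u v = A s v

  _·u : ℕ → Config n
  (k ·u) v = k * u v

  _∼_ : Config n → Config n → Set
  c ∼ d = ∃ λ k → StabilizesTo (c ⊕ (k ·u)) d

  dlvl : Config n → ℕ
  dlvl c = outdeg A s + ΣF (λ v → if does (v ≟ s) then 0 else c v)

  ClassDlvl : Config n → ℕ → Set
  ClassDlvl c k = (∃ λ d → Recurrent d × c ∼ d × dlvl d ≡ k)
                × ((d : Config n) → Recurrent d → c ∼ d → dlvl d ≤ k)

  -- there are exactly m classes of recurrent configurations of d-level k:
  -- f lists one representative of each class, without repetition.
  ClassCount : ℕ → ℕ → Set
  ClassCount k m =
    Σ (Fin m → Config n) λ f →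
        ((i : Fin m) → Recurrent (f i) × ClassDlvl (f i) k)
      × ((i j : Fin m) → f i ∼ f j → i ≡ j)
      × ((c : Config n) → Recurrent c → ClassDlvl c k → ∃ λ i → c ∼ f i)

-- Polynomials in y with ℕ coefficients, given by coefficient functions.

Poly : Set
Poly = ℕ → ℕ

-- b is the Biggs-Merino polynomial B(H,s;y): coefficient of y^k is the
-- number of classes of d-level k
IsBM : ∀ {n} → Adj n → Fin n → Poly → Set
IsBM A s b = (k : ℕ) → Sandpile.ClassCount A s k (b k)

_*P_ : Poly → Poly → Poly
(p *P q) k = Σ≤ k (λ i → p i * q (k ∸ i))

oneP : Poly
oneP zero    = 1
oneP (suc _) = 0

_^P_ : Poly → ℕ → Poly
p ^P zero  = oneP
p ^P suc m = p *P (p ^P m)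

-- p(y^d)
substPow : ℕ → Poly → Poly
substPow d p k = Σ≤ k (λ j → if does (d * j ≟ℕ k) then p j else 0)

-- (1 - y^d)/(1 - y) = 1 + y + ... + y^(d-1)
geomP : ℕ → Poly
geomP d k = if does (suc k Data.Nat.≤? d) then 1 else 0

module Submission where

-- Write a configuration c of G^d as c = c % d + (c / d)·d. Every out-degree and every entry of
-- u_s in G^d is d times the one in G, so v can legally fire in c (for G^d) exactly when it can in
-- c / d (for G), and firing it fires c / d in G while leaving c % d untouched. Consequently
-- stabilisation, recurrence and ∼ for G^d are those of G on quotients, together with equality of
-- remainders, and dlvl_{G^d}(c) = d · dlvl_G(c / d) + Σ_{v ≠ s} (c % d)(v). The classes of G^d of
-- d-level K thus correspond to pairs of a class of G of d-level k and a vector in [0, d)^{V ∖ s}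
-- with entry sum K − d k, and these vectors are counted by (1 + y + ⋯ + y^{d−1})^{|V|−1}.

open import Defs
open import Data.Bool using (Bool; false; if_then_else_)
open import Data.Empty using (⊥; ⊥-elim)
open import Data.Fin using (Fin; zero; suc)
open import Data.Fin.Properties using (_≟_; 0↔⊥; 1↔⊤; +↔⊎; *↔×)
open import Data.Nat using (ℕ; zero; suc; _+_; _*_; _∸_; _≤_; _<_; z≤n; s≤s; _≤?_; NonZero)
open import Data.Nat.DivMod
  using (_/_; _%_; m≡m%n+[m/n]*n; m%n<n; m/n*n≤m; /-monoˡ-≤; +-distrib-/; m<n⇒m/n≡0; m*n/n≡m;
         m<n⇒m%n≡m; m*n%n≡0; [m+kn]%n≡m%n)
open import Data.Nat.Properties
  using (≤-refl; ≤-reflexive; <⇒≤; ≰⇒>; <⇒≱; 1+n≰n; n≤0⇒n≡0; m≤n⇒m≤1+n; m≤n⇒m<n∨m≡n; m≤m+n; m≤n*m;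
         m+n∸m≡n; m+[n∸m]≡n; ∸-cancelˡ-≡; +-∸-assoc; +-identityʳ; +-mono-≤; +-cancelʳ-≤;
         *-comm; *-zeroʳ; *-distribˡ-+; *-distribʳ-∸; *-monoˡ-≤; *-monoʳ-≤; *-cancelˡ-≡; *-cancelˡ-≤;
         module ≤-Reasoning)
  renaming (_≟_ to _≟ℕ_)
open import Data.Nat.Tactic.RingSolver using (solve-∀)
open import Data.Product using (∃; ∃₂; _×_; _,_; proj₁; proj₂)
open import Data.Product.Relation.Binary.Pointwise.NonDependent using (Pointwise)
open import Data.Sum using (_⊎_; inj₁; inj₂)
open import Data.Unit using (tt)
open import Data.Vec.Functional using (_∷_; head; tail)
open import Function using (_∘_)
open import Function.Bundles using (_↔_; Inverse)
open import Relation.Binary.Construct.Closure.ReflexiveTransitive using (Star; ε; _◅_)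
open import Relation.Binary.PropositionalEquality
open import Relation.Nullary using (¬_; Dec; does; yes; no)
open import Relation.Nullary.Decidable using (dec-true; dec-false)
open import Relation.Unary using (Decidable)

record Transversal {X : Set} (I : Set) (P : X → Set) (_≈_ : X → X → Set) : Set where
  field
    element  : I → X
    valid    : ∀ i → P (element i)
    distinct : ∀ i j → element i ≈ element j → i ≡ j
    complete : ∀ {x} → P x → ∃ λ i → x ≈ element i

Enumeration : {X : Set} → (X → Set) → (X → X → Set) → ℕ → Set
Enumeration P _≈_ m = Transversal (Fin m) P _≈_

module _ {X : Set} {_≈_ : X → X → Set} where

  transversal-reindex : ∀ {I J P} → J ↔ I → Transversal I P _≈_ → Transversal J P _≈_
  transversal-reindex J↔I T = record
    { element  = element ∘ to
    ; valid    = valid ∘ to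
    ; distinct = λ j j' e →
        trans (sym (strictlyInverseʳ j)) (trans (cong from (distinct (to j) (to j') e)) (strictlyInverseʳ j'))
    ; complete = λ {x} p → let (i , x≈) = complete p in
        from i , subst (λ k → x ≈ element k) (sym (strictlyInverseˡ i)) x≈
    }
    where
    open Transversal T
    open Inverse J↔I

  transversal-⇔ : ∀ {I P Q} → (∀ {x} → P x → Q x) → (∀ {x} → Q x → P x)
    → Transversal I P _≈_ → Transversal I Q _≈_
  transversal-⇔ P⇒Q Q⇒P T = record
    { element = element ; valid = P⇒Q ∘ valid ; distinct = distinct ; complete = complete ∘ Q⇒P }
    where open Transversal T

  transversal-⊥ : ∀ {P} → (∀ {x} → ¬ P x) → Transversal ⊥ P _≈_
  transversal-⊥ ¬P = record
    { element = λ () ; valid = λ () ; distinct = λ () ; complete = λ p → ⊥-elim (¬P p) }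

  transversal-⊎ : ∀ {I J P Q} → Transversal I P _≈_ → Transversal J Q _≈_
    → (∀ {x y} → P x → Q y → ¬ x ≈ y) → (∀ {x y} → Q x → P y → ¬ x ≈ y)
    → Transversal (I ⊎ J) (λ x → P x ⊎ Q x) _≈_
  transversal-⊎ {I} {J} {P} {Q} TP TQ P≉Q Q≉P = record
    { element = element ; valid = valid ; distinct = distinct ; complete = complete }
    where
    module TP = Transversal TP
    module TQ = Transversal TQ
    element : I ⊎ J → X
    element (inj₁ i) = TP.element i
    element (inj₂ j) = TQ.element j
    valid : ∀ k → P (element k) ⊎ Q (element k)
    valid (inj₁ i) = inj₁ (TP.valid i)
    valid (inj₂ j) = inj₂ (TQ.valid j)
    distinct : ∀ k k' → element k ≈ element k' → k ≡ k'
    distinct (inj₁ i) (inj₁ i') e = cong inj₁ (TP.distinct i i' e)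
    distinct (inj₁ i) (inj₂ j) e = ⊥-elim (P≉Q (TP.valid i) (TQ.valid j) e)
    distinct (inj₂ j) (inj₁ i) e = ⊥-elim (Q≉P (TQ.valid j) (TP.valid i) e)
    distinct (inj₂ j) (inj₂ j') e = cong inj₂ (TQ.distinct j j' e)
    complete : ∀ {x} → P x ⊎ Q x → ∃ λ k → x ≈ element k
    complete (inj₁ p) = let (i , e) = TP.complete p in inj₁ i , e
    complete (inj₂ q) = let (j , e) = TQ.complete q in inj₂ j , e

transversal-× : ∀ {X Y I J : Set} {P : X → Set} {Q : Y → Set} {_≈_ : X → X → Set} {_≋_ : Y → Y → Set}
  → Transversal I P _≈_ → Transversal J Q _≋_
  → Transversal (I × J) (λ (x , y) → P x × Q y) (Pointwise _≈_ _≋_)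
transversal-× TP TQ = record
  { element  = λ (i , j) → TP.element i , TQ.element j
  ; valid    = λ (i , j) → TP.valid i , TQ.valid j
  ; distinct = λ (i , j) (i' , j') (e , e') → cong₂ _,_ (TP.distinct i i' e) (TQ.distinct j j' e')
  ; complete = λ (p , q) → let (i , e) = TP.complete p ; (j , e') = TQ.complete q in (i , j) , e , e'
  }
  where
  module TP = Transversal TP
  module TQ = Transversal TQ

transversal-map : ∀ {X Y I : Set} {P : X → Set} {Q : Y → Set} {_≈_ : X → X → Set} {_≋_ : Y → Y → Set}
  → (h : X → Y)
  → (∀ {x} → P x → Q (h x))
  → (∀ {x x'} → P x → P x' → h x ≋ h x' → x ≈ x')
  → (∀ {y} → Q y → ∃ λ x → P x × (∀ {x'} → P x' → x ≈ x' → y ≋ h x'))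
  → Transversal I P _≈_ → Transversal I Q _≋_
transversal-map h P⇒Q reflect reach T = record
  { element  = h ∘ element
  ; valid    = P⇒Q ∘ valid
  ; distinct = λ i j e → distinct i j (reflect (valid i) (valid j) e)
  ; complete = λ q → let (x , p , y≋) = reach q ; (i , x≈) = complete p in i , y≋ (valid i) x≈
  }
  where open Transversal T

module _ {X : Set} {_≈_ : X → X → Set} where

  enum-Σ≤ : ∀ k {P : ℕ → X → Set} {m : ℕ → ℕ}
    → (∀ j → j ≤ k → Enumeration (P j) _≈_ (m j))
    → (∀ {j j' x y} → j ≤ k → j' ≤ k → P j x → P j' y → x ≈ y → j ≡ j')
    → Enumeration (λ x → ∃ λ j → j ≤ k × P j x) _≈_ (Σ≤ k m)
  enum-Σ≤ zero {P} en _ =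
    transversal-⇔ (λ p → 0 , z≤n , p) (λ (j , j≤0 , p) → subst (λ j → P j _) (n≤0⇒n≡0 j≤0) p) (en 0 z≤n)
  enum-Σ≤ (suc k) {P} en disjoint =
    transversal-reindex +↔⊎ (transversal-⇔ widen split (transversal-⊎ below top below≉top top≉below))
    where
    below = enum-Σ≤ k (λ j j≤k → en j (m≤n⇒m≤1+n j≤k))
                      (λ j≤k j'≤k → disjoint (m≤n⇒m≤1+n j≤k) (m≤n⇒m≤1+n j'≤k))
    top = en (suc k) ≤-refl
    below≉top : ∀ {x y} → (∃ λ j → j ≤ k × P j x) → P (suc k) y → ¬ x ≈ y
    below≉top (j , j≤k , p) q e with refl ← disjoint (m≤n⇒m≤1+n j≤k) ≤-refl p q e = 1+n≰n j≤k
    top≉below : ∀ {x y} → P (suc k) x → (∃ λ j → j ≤ k × P j y) → ¬ x ≈ y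
    top≉below q (j , j≤k , p) e with refl ← disjoint ≤-refl (m≤n⇒m≤1+n j≤k) q p e = 1+n≰n j≤k
    widen : ∀ {x} → (∃ λ j → j ≤ k × P j x) ⊎ P (suc k) x → ∃ λ j → j ≤ suc k × P j x
    widen (inj₁ (j , j≤k , p)) = j , m≤n⇒m≤1+n j≤k , p
    widen (inj₂ p) = suc k , ≤-refl , p
    split : ∀ {x} → (∃ λ j → j ≤ suc k × P j x) → (∃ λ j → j ≤ k × P j x) ⊎ P (suc k) x
    split (j , j≤ , p) with m≤n⇒m<n∨m≡n j≤
    ... | inj₁ (s≤s j≤k) = inj₁ (j , j≤k , p)
    ... | inj₂ refl = inj₂ p

  enum-substPow : ∀ d .{{_ : NonZero d}} {P : ℕ → X → Set} {b : Poly}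
    → (∀ j → Enumeration (P j) _≈_ (b j))
    → ∀ i → Enumeration (λ x → ∃ λ j → d * j ≡ i × P j x) _≈_ (substPow d b i)
  enum-substPow d {P} {b} en i =
    transversal-⇔ (λ (j , _ , dj≡i , p) → j , dj≡i , p)
                  (λ (j , dj≡i , p) → j , subst (j ≤_) dj≡i (m≤n*m j d) , dj≡i , p)
                  (enum-Σ≤ i piece
                    (λ _ _ (dj≡i , _) (dj'≡i , _) _ → *-cancelˡ-≡ _ _ d (trans dj≡i (sym dj'≡i))))
    where
    piece : ∀ j → j ≤ i → Enumeration (λ x → d * j ≡ i × P j x) _≈_ (if does (d * j ≟ℕ i) then b j else 0)
    piece j _ = byEquation (d * j ≟ℕ i)
      where
      byEquation : (dj≟i : Dec (d * j ≡ i))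
        → Enumeration (λ x → d * j ≡ i × P j x) _≈_ (if does dj≟i then b j else 0)
      byEquation (yes dj≡i) = transversal-⇔ (dj≡i ,_) proj₂ (en j)
      byEquation (no dj≢i) = transversal-reindex 0↔⊥ (transversal-⊥ (dj≢i ∘ proj₁))

enum-digit : ∀ d i → Enumeration (λ a → a ≡ i × i < d) _≡_ (geomP d i)
enum-digit d i = byBound (suc i ≤? d)
  where
  Count = λ t → Enumeration (λ a → a ≡ i × i < d) _≡_ (if t then 1 else 0)
  byBound : (i<d? : Dec (i < d)) → Count (does i<d?)
  byBound (yes i<d) = transversal-reindex 1↔⊤ (record
    { element = λ _ → i ; valid = λ _ → refl , i<d
    ; distinct = λ _ _ _ → refl ; complete = λ (a≡i , _) → tt , a≡i })
  byBound (no i≮d) = transversal-reindex 0↔⊥ (transversal-⊥ (i≮d ∘ proj₂))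

Convolution : {X Y : Set} → ℕ → (ℕ → X → Set) → (ℕ → Y → Set) → X × Y → Set
Convolution K P Q (x , y) = ∃₂ λ i j → i + j ≡ K × P i x × Q j y

module _ {X Y : Set} {_≈_ : X → X → Set} {_≋_ : Y → Y → Set} where

  enum-*P : ∀ {P Q} {p q : Poly} K
    → (∀ i → Enumeration (P i) _≈_ (p i))
    → (∀ j → Enumeration (Q j) _≋_ (q j))
    → (∀ {j j' y y'} → Q j y → Q j' y' → y ≋ y' → j ≡ j')
    → Enumeration (Convolution K P Q) (Pointwise _≈_ _≋_) ((p *P q) K)
  enum-*P {P} {Q} K enP enQ Q-determined =
    transversal-⇔ toConvolution fromConvolution
      (enum-Σ≤ K (λ i _ → transversal-reindex *↔× (transversal-× (enP i) (enQ (K ∸ i))))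
        (λ i≤K i'≤K (_ , q) (_ , q') (_ , y≋y') → ∸-cancelˡ-≡ i≤K i'≤K (Q-determined q q' y≋y')))
    where
    toConvolution : ∀ {x y} → (∃ λ i → i ≤ K × P i x × Q (K ∸ i) y) → Convolution K P Q (x , y)
    toConvolution (i , i≤K , p , q) = i , K ∸ i , m+[n∸m]≡n i≤K , p , q
    fromConvolution : ∀ {x y} → Convolution K P Q (x , y) → ∃ λ i → i ≤ K × P i x × Q (K ∸ i) y
    fromConvolution {y = y} (i , j , refl , p , q) =
      i , m≤m+n i j , p , subst (λ j → Q j y) (sym (m+n∸m≡n i j)) q

ΣF-cong : ∀ {n} {f g : Fin n → ℕ} → (∀ v → f v ≡ g v) → ΣF f ≡ ΣF g
ΣF-cong {zero} _ = refl
ΣF-cong {suc n} f≗g = cong₂ _+_ (f≗g zero) (ΣF-cong (f≗g ∘ suc))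

ΣF-+ : ∀ {n} (f g : Fin n → ℕ) → ΣF (λ v → f v + g v) ≡ ΣF f + ΣF g
ΣF-+ {zero} f g = refl
ΣF-+ {suc n} f g rewrite ΣF-+ (f ∘ suc) (g ∘ suc) =
  +-interchange (f zero) (g zero) (ΣF (f ∘ suc)) (ΣF (g ∘ suc))
  where
  +-interchange : ∀ a b c e → (a + b) + (c + e) ≡ (a + c) + (b + e)
  +-interchange = solve-∀

ΣF-*ˡ : ∀ {n} d (f : Fin n → ℕ) → ΣF (λ v → d * f v) ≡ d * ΣF f
ΣF-*ˡ {zero} d f = sym (*-zeroʳ d)
ΣF-*ˡ {suc n} d f rewrite ΣF-*ˡ d (f ∘ suc) = sym (*-distribˡ-+ d (f zero) (ΣF (f ∘ suc)))

-- With Z = (_≡ s), ΣF (mask Z? c) is the chip count of dlvl.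
mask : ∀ {n} {Z : Fin n → Set} → Decidable Z → (Fin n → ℕ) → Fin n → ℕ
mask Z? ρ v = if does (Z? v) then 0 else ρ v

falses : ∀ {n} → (Fin n → Bool) → ℕ
falses {zero} _ = 0
falses {suc n} b = if b zero then falses (b ∘ suc) else suc (falses (b ∘ suc))

falses-const : ∀ n → falses {n} (λ _ → false) ≡ n
falses-const zero = refl
falses-const (suc n) = cong suc (falses-const n)

falses-≟ : ∀ {n} (s : Fin n) → falses (λ v → does (v ≟ s)) ≡ n ∸ 1
falses-≟ {suc n} zero = falses-const n
falses-≟ {suc (suc n)} (suc s) = cong suc (falses-≟ s)

AgreeOff : ∀ {n} → (Fin n → Set) → (Fin n → ℕ) → (Fin n → ℕ) → Set
AgreeOff Z ρ ρ' = ∀ v → ¬ Z v → ρ v ≡ ρ' v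

module _ {n} {Z : Fin (suc n) → Set} (Z? : Decidable Z) where

  ΣF-mask-masked-head : ∀ ρ → Z zero → ΣF (mask Z? ρ) ≡ ΣF (mask (Z? ∘ suc) (tail ρ))
  ΣF-mask-masked-head ρ z =
    cong (λ t → (if t then 0 else head ρ) + ΣF (mask (Z? ∘ suc) (tail ρ))) (dec-true (Z? zero) z)

  ΣF-mask-unmasked-head : ∀ ρ → ¬ Z zero → ΣF (mask Z? ρ) ≡ head ρ + ΣF (mask (Z? ∘ suc) (tail ρ))
  ΣF-mask-unmasked-head ρ ¬z =
    cong (λ t → (if t then 0 else head ρ) + ΣF (mask (Z? ∘ suc) (tail ρ))) (dec-false (Z? zero) ¬z)

module _ {n} {Z : Fin n → Set} (Z? : Decidable Z) where

  ΣF-mask-cong : ∀ {ρ ρ'} → AgreeOff Z ρ ρ' → ΣF (mask Z? ρ) ≡ ΣF (mask Z? ρ')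
  ΣF-mask-cong {ρ} {ρ'} ρ≐ρ' = ΣF-cong agree
    where
    agree : ∀ v → mask Z? ρ v ≡ mask Z? ρ' v
    agree v with Z? v
    ... | yes _ = refl
    ... | no ¬z = ρ≐ρ' v ¬z

module _ (d : ℕ) where

  Residue : ∀ {n} {Z : Fin n → Set} → Decidable Z → ℕ → (Fin n → ℕ) → Set
  Residue {Z = Z} Z? m ρ = (∀ v → ¬ Z v → ρ v < d) × ΣF (mask Z? ρ) ≡ m

  Residue-determined : ∀ {n} {Z : Fin n → Set} (Z? : Decidable Z) {j j' ρ ρ'}
    → Residue Z? j ρ → Residue Z? j' ρ' → AgreeOff Z ρ ρ' → j ≡ j'
  Residue-determined Z? (_ , Σρ≡j) (_ , Σρ'≡j') ρ≐ρ' = trans (sym Σρ≡j) (trans (ΣF-mask-cong Z? ρ≐ρ') Σρ'≡j')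

  module _ {n} {Z : Fin (suc n) → Set} (Z? : Decidable Z) where

    residues-masked-head : ∀ {m c} → Z zero
      → Enumeration (Residue (Z? ∘ suc) m) (AgreeOff (Z ∘ suc)) c
      → Enumeration (Residue Z? m) (AgreeOff Z) c
    residues-masked-head {m} z = transversal-map (0 ∷_) extend (λ _ _ ρ≐ρ' → ρ≐ρ' ∘ suc) reach
      where
      extend : ∀ {τ} → Residue (Z? ∘ suc) m τ → Residue Z? m (0 ∷ τ)
      extend (τ<d , Στ≡m) = (λ { zero ¬z → ⊥-elim (¬z z) ; (suc v) → τ<d v }) ,
                            trans (ΣF-mask-masked-head Z? (0 ∷ _) z) Στ≡m
      reach : ∀ {ρ} → Residue Z? m ρ →
        ∃ λ τ → Residue (Z? ∘ suc) m τ
          × (∀ {τ'} → Residue (Z? ∘ suc) m τ' → AgreeOff (Z ∘ suc) τ τ' → AgreeOff Z ρ (0 ∷ τ'))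
      reach {ρ} (ρ<d , Σρ≡m) =
        tail ρ , (ρ<d ∘ suc , trans (sym (ΣF-mask-masked-head Z? ρ z)) Σρ≡m) ,
        λ { _ τ≐τ' zero ¬z → ⊥-elim (¬z z) ; _ τ≐τ' (suc v) → τ≐τ' v }

    residues-unmasked-head : ∀ {q : Poly} m → ¬ Z zero
      → (∀ j → Enumeration (Residue (Z? ∘ suc) j) (AgreeOff (Z ∘ suc)) (q j))
      → Enumeration (Residue Z? m) (AgreeOff Z) ((geomP d *P q) m)
    residues-unmasked-head m ¬z enTail =
      transversal-map (λ (a , τ) → a ∷ τ) extend (λ _ _ ρ≐ρ' → ρ≐ρ' zero ¬z , ρ≐ρ' ∘ suc) reach
        (enum-*P {p = geomP d} m (enum-digit d) enTail
          (Residue-determined (Z? ∘ suc)))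
      where
      Digit : ℕ → ℕ → Set
      Digit i a = a ≡ i × i < d
      extend : ∀ {aτ} → Convolution m Digit (Residue (Z? ∘ suc)) aτ → Residue Z? m (proj₁ aτ ∷ proj₂ aτ)
      extend (i , j , refl , (refl , i<d) , (τ<d , Στ≡j)) =
        (λ { zero _ → i<d ; (suc v) → τ<d v }) ,
        trans (ΣF-mask-unmasked-head Z? (i ∷ _) ¬z) (cong (i +_) Στ≡j)
      reach : ∀ {ρ} → Residue Z? m ρ → ∃ λ aτ → Convolution m Digit (Residue (Z? ∘ suc)) aτ
        × (∀ {aτ'} → Convolution m Digit (Residue (Z? ∘ suc)) aτ'
             → Pointwise _≡_ (AgreeOff (Z ∘ suc)) aτ aτ' → AgreeOff Z ρ (proj₁ aτ' ∷ proj₂ aτ'))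
      reach {ρ} (ρ<d , Σρ≡m) =
        (head ρ , tail ρ) ,
        (head ρ , _ , trans (sym (ΣF-mask-unmasked-head Z? ρ ¬z)) Σρ≡m ,
          (refl , ρ<d zero ¬z) , (ρ<d ∘ suc , refl)) ,
        λ { _ (a≡a' , _) zero _ → a≡a' ; _ (_ , τ≐τ') (suc v) → τ≐τ' v }

  enum-residues : ∀ {n} {Z : Fin n → Set} (Z? : Decidable Z) m
    → Enumeration (Residue Z? m) (AgreeOff Z) ((geomP d ^P falses (does ∘ Z?)) m)
  enum-residues {zero} Z? zero = transversal-reindex 1↔⊤ (record
    { element = λ _ () ; valid = λ _ → (λ ()) , refl
    ; distinct = λ _ _ _ → refl ; complete = λ _ → tt , λ () })
  enum-residues {zero} Z? (suc m) = transversal-reindex 0↔⊥ (transversal-⊥ λ ())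
  enum-residues {suc n} {Z} Z? m = byHead (Z? zero)
    where
    falses-tail = falses (does ∘ Z? ∘ suc)
    byHead : (z? : Dec (Z zero)) → Enumeration (Residue Z? m) (AgreeOff Z)
                                      ((geomP d ^P (if does z? then falses-tail else suc falses-tail)) m)
    byHead (yes z) = residues-masked-head Z? z (enum-residues (Z? ∘ suc) m)
    byHead (no ¬z) = residues-unmasked-head Z? m ¬z (enum-residues (Z? ∘ suc))

module _ {x r n : ℕ} .{{_ : NonZero n}} (q : ℕ) (r<n : r < n) (x≡ : x ≡ r + q * n) where

  /-unique : x / n ≡ q
  /-unique = begin
    x / n                 ≡⟨ cong (_/ n) x≡ ⟩
    (r + q * n) / n       ≡⟨ +-distrib-/ r (q * n) remainders<n ⟩
    r / n + q * n / n     ≡⟨ cong₂ _+_ (m<n⇒m/n≡0 r<n) (m*n/n≡m q n) ⟩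
    q                     ∎
    where
    open ≡-Reasoning
    remainders<n : r % n + q * n % n < n
    remainders<n = subst (_< n) (sym (trans (cong₂ _+_ (m<n⇒m%n≡m r<n) (m*n%n≡0 q n)) (+-identityʳ r))) r<n

  %-unique : x % n ≡ r
  %-unique = trans (cong (_% n) x≡) (trans ([m+kn]%n≡m%n r q n) (m<n⇒m%n≡m r<n))

collect : ∀ r q a d → r + q * d + d * a ≡ r + (q + a) * d
collect = solve-∀

outdeg-power : ∀ {n} d (A : Adj n) v → outdeg (power d A) v ≡ d * outdeg A v
outdeg-power d A v = ΣF-*ˡ d (A v)

module SandpileProperties {n : ℕ} (A : Adj n) (s : Fin n) where
  open Sandpile A s public

  ≐-refl : ∀ {c} → c ≐ c
  ≐-refl _ _ = refl

  ≐-sym : ∀ {c c'} → c ≐ c' → c' ≐ c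
  ≐-sym c≐c' v v≢s = sym (c≐c' v v≢s)

  ≐-trans : ∀ {c c' c''} → c ≐ c' → c' ≐ c'' → c ≐ c''
  ≐-trans c≐c' c'≐c'' v v≢s = trans (c≐c' v v≢s) (c'≐c'' v v≢s)

  fire-cong : ∀ v {c c'} → c ≐ c' → fire v c ≐ fire v c'
  fire-cong v c≐c' w w≢s = cong (λ t → (if does (w ≟ v) then t ∸ outdeg A v else t) + A v w) (c≐c' w w≢s)

  StabilizesTo-congˡ : ∀ {c c' e} → c ≐ c' → StabilizesTo c e → StabilizesTo c' e
  StabilizesTo-congˡ c≐c' (e' , ε , e'≐e , stable) = _ , ε , ≐-trans (≐-sym c≐c') e'≐e , stable
  StabilizesTo-congˡ c≐c' (e' , (v , v≢s , legal , c₁≐) ◅ steps , e'≐e , stable) =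
    e' , (v , v≢s , subst (outdeg A v ≤_) (c≐c' v v≢s) legal , ≐-trans c₁≐ (fire-cong v c≐c')) ◅ steps ,
    e'≐e , stable

  StabilizesTo-congʳ : ∀ {c e e'} → e ≐ e' → StabilizesTo c e → StabilizesTo c e'
  StabilizesTo-congʳ e≐e' (e'' , steps , e''≐e , stable) =
    e'' , steps , ≐-trans e''≐e e≐e' , λ v v≢s → subst (_< outdeg A v) (e≐e' v v≢s) (stable v v≢s)

  Recurrent-cong : ∀ {c c'} → c ≐ c' → Recurrent c → Recurrent c'
  Recurrent-cong c≐c' rec c₁ = let (c₂ , stab) = rec c₁ in c₂ , StabilizesTo-congʳ c≐c' stab

  ∼-cong : ∀ {c c' e e'} → c ≐ c' → e ≐ e' → c ∼ e → c' ∼ e'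
  ∼-cong c≐c' e≐e' (k , stab) =
    k , StabilizesTo-congʳ e≐e' (StabilizesTo-congˡ (λ v v≢s → cong (_+ (k ·u) v) (c≐c' v v≢s)) stab)

  RecurrentAtLevel : ℕ → Config n → Set
  RecurrentAtLevel k c = Recurrent c × ClassDlvl c k

  enumeration-from-classCount : ∀ {k m} → ClassCount k m → Enumeration (RecurrentAtLevel k) _∼_ m
  enumeration-from-classCount (f , valid , distinct , complete) = record
    { element = f ; valid = valid ; distinct = distinct ; complete = λ (rec , cd) → complete _ rec cd }

  classCount-from-enumeration : ∀ {k m} → Enumeration (RecurrentAtLevel k) _∼_ m → ClassCount k m
  classCount-from-enumeration T = element , valid , distinct , λ _ rec cd → complete (rec , cd)
    where open Transversal T

module PowerGraph {n : ℕ} (A : Adj n) (s : Fin n) (d-1 : ℕ) where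

  d : ℕ
  d = suc d-1

  module G = SandpileProperties A s
  module H = SandpileProperties (power d A) s

  quot rem : Config n → Config n
  quot c v = c v / d
  rem c v = c v % d

  lift : Config n → Config n → Config n
  lift e ρ v = ρ v + e v * d

  IsResidue : Config n → Set
  IsResidue ρ = ∀ v → ¬ v ≡ s → ρ v < d

  weight : Config n → ℕ
  weight ρ = ΣF (mask (_≟ s) ρ)

  rem<d : ∀ c v → rem c v < d
  rem<d c v = m%n<n (c v) d

  rem-residue : ∀ c → IsResidue (rem c)
  rem-residue c v _ = rem<d c v

  rem+quot*d : ∀ c v → c v ≡ rem c v + quot c v * d
  rem+quot*d c v = m≡m%n+[m/n]*n (c v) d

  ≐-from-quot-rem : ∀ {c c'} → quot c G.≐ quot c' → rem c H.≐ rem c' → c H.≐ c'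
  ≐-from-quot-rem {c} {c'} q≐ r≐ v v≢s =
    trans (rem+quot*d c v) (trans (cong₂ (λ a b → a + b * d) (r≐ v v≢s) (q≐ v v≢s)) (sym (rem+quot*d c' v)))

  quot-lift : ∀ e {ρ} → IsResidue ρ → quot (lift e ρ) G.≐ e
  quot-lift e ρ<d v v≢s = /-unique (e v) (ρ<d v v≢s) refl

  rem-lift : ∀ e {ρ} → IsResidue ρ → rem (lift e ρ) H.≐ ρ
  rem-lift e ρ<d v v≢s = %-unique (e v) (ρ<d v v≢s) refl

  weight-cong : ∀ {ρ ρ'} → ρ H.≐ ρ' → weight ρ ≡ weight ρ'
  weight-cong = ΣF-mask-cong (_≟ s)

  legal-quot : ∀ {c v} → outdeg (power d A) v ≤ c v → outdeg A v ≤ quot c v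
  legal-quot {c} {v} legal = begin
    outdeg A v              ≡⟨ m*n/n≡m (outdeg A v) d ⟨
    outdeg A v * d / d      ≤⟨ /-monoˡ-≤ d (subst (_≤ c v) (trans (outdeg-power d A v) (*-comm d _)) legal) ⟩
    quot c v                ∎
    where open ≤-Reasoning

  legal-from-quot : ∀ {c v} → outdeg A v ≤ quot c v → outdeg (power d A) v ≤ c v
  legal-from-quot {c} {v} legal = begin
    outdeg (power d A) v    ≡⟨ trans (outdeg-power d A v) (*-comm d _) ⟩
    outdeg A v * d          ≤⟨ *-monoˡ-≤ d legal ⟩
    quot c v * d            ≤⟨ m/n*n≤m (c v) d ⟩
    c v                     ∎
    where open ≤-Reasoning

  stable-quot : ∀ {c} → H.Stable c → G.Stable (quot c)
  stable-quot {c} stable v v≢s = ≰⇒> λ legal → <⇒≱ (stable v v≢s) (legal-from-quot {c} legal)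

  stable-from-quot : ∀ {c} → G.Stable (quot c) → H.Stable c
  stable-from-quot {c} stable v v≢s = ≰⇒> λ legal → <⇒≱ (stable v v≢s) (legal-quot {c} legal)

  fire-digits : ∀ {c v} → outdeg A v ≤ quot c v → ∀ w → H.fire v c w ≡ rem c w + G.fire v (quot c) w * d
  fire-digits {c} {v} legal w with w ≟ v
  ... | yes refl = begin
    c v ∸ outdeg (power d A) v + d * A v v
      ≡⟨ cong₂ (λ x y → x ∸ y + d * A v v) (rem+quot*d c v) (trans (outdeg-power d A v) (*-comm d _)) ⟩
    rem c v + quot c v * d ∸ outdeg A v * d + d * A v v
      ≡⟨ cong (_+ d * A v v) (+-∸-assoc (rem c v) (*-monoˡ-≤ d legal)) ⟩
    rem c v + (quot c v * d ∸ outdeg A v * d) + d * A v v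
      ≡⟨ cong (λ x → rem c v + x + d * A v v) (sym (*-distribʳ-∸ d (quot c v) (outdeg A v))) ⟩
    rem c v + (quot c v ∸ outdeg A v) * d + d * A v v
      ≡⟨ collect (rem c v) (quot c v ∸ outdeg A v) (A v v) d ⟩
    rem c v + (quot c v ∸ outdeg A v + A v v) * d  ∎
    where open ≡-Reasoning
  ... | no _ = trans (cong (_+ d * A v w) (rem+quot*d c w)) (collect (rem c w) (quot c w) (A v w) d)

  quot-fire : ∀ {c v} → outdeg A v ≤ quot c v → ∀ w → quot (H.fire v c) w ≡ G.fire v (quot c) w
  quot-fire {c} {v} legal w = /-unique (G.fire v (quot c) w) (rem<d c w) (fire-digits {c} legal w)

  rem-fire : ∀ {c v} → outdeg A v ≤ quot c v → ∀ w → rem (H.fire v c) w ≡ rem c w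
  rem-fire {c} {v} legal w = %-unique (G.fire v (quot c) w) (rem<d c w) (fire-digits {c} legal w)

  star-quot : ∀ {c e} → Star H.Step c e → Star G.Step (quot c) (quot e) × rem c H.≐ rem e
  star-quot ε = ε , H.≐-refl
  star-quot {c} ((v , v≢s , legal , c₁≐) ◅ steps) =
    let (gsteps , rem≐) = star-quot steps
    in (v , v≢s , legal' , λ w w≢s → trans (cong (_/ d) (c₁≐ w w≢s)) (quot-fire {c} legal' w)) ◅ gsteps ,
       H.≐-trans (λ w w≢s → sym (trans (cong (_% d) (c₁≐ w w≢s)) (rem-fire {c} legal' w))) rem≐
    where legal' = legal-quot {c} legal

  -- Generalised from p = quot c so that the induction goes through.
  star-from-quot : ∀ {p p' c} → p G.≐ quot c → Star G.Step p p'
    → ∃ λ e → Star H.Step c e × p' G.≐ quot e × rem c H.≐ rem e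
  star-from-quot p≐ ε = _ , ε , p≐ , H.≐-refl
  star-from-quot {c = c} p≐ ((v , v≢s , legal , p₁≐) ◅ steps) =
    let (e , hsteps , p'≐ , rem≐) = star-from-quot p₁≐quot steps
    in e , (v , v≢s , legal-from-quot {c} legal' , H.≐-refl) ◅ hsteps , p'≐ ,
       H.≐-trans (λ w _ → sym (rem-fire {c} legal' w)) rem≐
    where
    legal' = subst (outdeg A v ≤_) (p≐ v v≢s) legal
    p₁≐quot = G.≐-trans p₁≐ (G.≐-trans (G.fire-cong v p≐) (λ w _ → sym (quot-fire {c} legal' w)))

  stabilizes-quot : ∀ {c e} → H.StabilizesTo c e → G.StabilizesTo (quot c) (quot e) × rem c H.≐ rem e
  stabilizes-quot (e' , steps , e'≐e , stable) =
    let (gsteps , rem≐) = star-quot steps in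
    (quot e' , gsteps , (λ v v≢s → cong (_/ d) (e'≐e v v≢s)) , stable-quot stable) ,
    H.≐-trans rem≐ (λ v v≢s → cong (_% d) (e'≐e v v≢s))

  stabilizes-from-quot : ∀ {c e} → G.StabilizesTo (quot c) (quot e) → rem c H.≐ rem e → H.StabilizesTo c e
  stabilizes-from-quot (p , steps , p≐ , stable) rem≐ =
    let (e' , hsteps , p≐' , rem≐') = star-from-quot G.≐-refl steps in
    e' , hsteps , ≐-from-quot-rem (G.≐-trans (G.≐-sym p≐') p≐) (H.≐-trans (H.≐-sym rem≐') rem≐) ,
    stable-from-quot stable

  recurrent-quot : ∀ {c} → H.Recurrent c → G.Recurrent (quot c)
  recurrent-quot rec c₁ =
    quot c₂ , G.StabilizesTo-congˡ (λ v _ → /-unique (c₁ v + quot c₂ v) (rem<d c₂ v) (digits v))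
                                   (proj₁ (stabilizes-quot (proj₂ (rec C₁))))
    where
    C₁ = λ v → c₁ v * d
    c₂ = proj₁ (rec C₁)
    shift : ∀ a r q d → a * d + (r + q * d) ≡ r + (a + q) * d
    shift = solve-∀
    digits : ∀ v → C₁ v + c₂ v ≡ rem c₂ v + (c₁ v + quot c₂ v) * d
    digits v = trans (cong (C₁ v +_) (rem+quot*d c₂ v)) (shift (c₁ v) (rem c₂ v) (quot c₂ v) d)

  -- C₂ tops C₁ up to a multiple of d, then adds the residue of c and a lift of G's witness.
  recurrent-from-quot : ∀ {c} → G.Recurrent (quot c) → H.Recurrent c
  recurrent-from-quot {c} rec C₁ =
    C₂ , stabilizes-from-quot (G.StabilizesTo-congˡ quot≐ stab) rem≐
    where
    x = proj₁ (rec (λ v → suc (quot C₁ v)))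
    stab = proj₂ (rec (λ v → suc (quot C₁ v)))
    C₂ : Config n
    C₂ v = (d ∸ rem C₁ v) + rem c v + x v * d
    digits : ∀ v → C₁ v + C₂ v ≡ rem c v + (suc (quot C₁ v) + x v) * d
    digits v = begin
      C₁ v + C₂ v
        ≡⟨ cong (_+ C₂ v) (rem+quot*d C₁ v) ⟩
      rem C₁ v + quot C₁ v * d + (d ∸ rem C₁ v + rem c v + x v * d)
        ≡⟨ regroup (rem C₁ v) (quot C₁ v) (d ∸ rem C₁ v) (rem c v) (x v) d ⟩
      rem c v + (rem C₁ v + (d ∸ rem C₁ v)) + (quot C₁ v + x v) * d
        ≡⟨ cong (λ t → rem c v + t + (quot C₁ v + x v) * d) (m+[n∸m]≡n (<⇒≤ (rem<d C₁ v))) ⟩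
      rem c v + d + (quot C₁ v + x v) * d
        ≡⟨ absorb (rem c v) (quot C₁ v) (x v) d ⟩
      rem c v + (suc (quot C₁ v) + x v) * d ∎
      where
      open ≡-Reasoning
      regroup : ∀ r₁ q₁ t r y d → r₁ + q₁ * d + (t + r + y * d) ≡ r + (r₁ + t) + (q₁ + y) * d
      regroup = solve-∀
      absorb : ∀ r q y d → r + d + (q + y) * d ≡ r + (suc q + y) * d
      absorb = solve-∀
    quot≐ : (λ v → suc (quot C₁ v) + x v) G.≐ quot (C₁ H.⊕ C₂)
    quot≐ v _ = sym (/-unique (suc (quot C₁ v) + x v) (rem<d c v) (digits v))
    rem≐ : rem (C₁ H.⊕ C₂) H.≐ rem c
    rem≐ v _ = %-unique (suc (quot C₁ v) + x v) (rem<d c v) (digits v)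

  ⊕u-digits : ∀ c k v → (c H.⊕ (k H.·u)) v ≡ rem c v + (quot c G.⊕ (k G.·u)) v * d
  ⊕u-digits c k v =
    trans (cong (_+ k * (d * A s v)) (rem+quot*d c v)) (distribute (rem c v) (quot c v) k (A s v) d)
    where
    distribute : ∀ r q k a d → r + q * d + k * (d * a) ≡ r + (q + k * a) * d
    distribute = solve-∀

  quot-⊕u : ∀ c k → quot (c H.⊕ (k H.·u)) G.≐ (quot c G.⊕ (k G.·u))
  quot-⊕u c k v _ = /-unique ((quot c G.⊕ (k G.·u)) v) (rem<d c v) (⊕u-digits c k v)

  rem-⊕u : ∀ c k → rem (c H.⊕ (k H.·u)) H.≐ rem c
  rem-⊕u c k v _ = %-unique ((quot c G.⊕ (k G.·u)) v) (rem<d c v) (⊕u-digits c k v)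

  ∼-quot : ∀ {c c'} → c H.∼ c' → quot c G.∼ quot c' × rem c H.≐ rem c'
  ∼-quot {c} (k , stab) =
    let (gstab , rem≐) = stabilizes-quot stab in
    (k , G.StabilizesTo-congˡ (quot-⊕u c k) gstab) , H.≐-trans (H.≐-sym (rem-⊕u c k)) rem≐

  ∼-from-quot : ∀ {c c'} → quot c G.∼ quot c' → rem c H.≐ rem c' → c H.∼ c'
  ∼-from-quot {c} (k , stab) rem≐ =
    k , stabilizes-from-quot (G.StabilizesTo-congˡ (G.≐-sym (quot-⊕u c k)) stab) (H.≐-trans (rem-⊕u c k) rem≐)

  dlvl-power : ∀ c → H.dlvl c ≡ d * G.dlvl (quot c) + weight (rem c)
  dlvl-power c = begin
    outdeg (power d A) s + ΣF (mask (_≟ s) c)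
      ≡⟨ cong₂ _+_ (outdeg-power d A s) (ΣF-cong mask-digits) ⟩
    d * outdeg A s + ΣF (λ v → mask (_≟ s) (rem c) v + d * mask (_≟ s) (quot c) v)
      ≡⟨ cong (d * outdeg A s +_) (trans (ΣF-+ (mask (_≟ s) (rem c)) (λ v → d * mask (_≟ s) (quot c) v))
                                          (cong (weight (rem c) +_) (ΣF-*ˡ d (mask (_≟ s) (quot c))))) ⟩
    d * outdeg A s + (weight (rem c) + d * weight (quot c))
      ≡⟨ regroup (outdeg A s) (weight (rem c)) (weight (quot c)) d ⟩
    d * (outdeg A s + weight (quot c)) + weight (rem c) ∎
    where
    open ≡-Reasoning
    mask-digits : ∀ v → mask (_≟ s) c v ≡ mask (_≟ s) (rem c) v + d * mask (_≟ s) (quot c) v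
    mask-digits v with v ≟ s
    ... | yes _ = sym (*-zeroʳ d)
    ... | no _ = trans (rem+quot*d c v) (cong (rem c v +_) (*-comm (quot c v) d))
    regroup : ∀ o r q d → d * o + (r + d * q) ≡ d * (o + q) + r
    regroup = solve-∀

  dlvl-lift : ∀ {e ρ} → IsResidue ρ → H.dlvl (lift e ρ) ≡ d * G.dlvl e + weight ρ
  dlvl-lift {e} ρ<d = trans (dlvl-power _)
    (cong₂ (λ a b → d * (outdeg A s + a) + b) (weight-cong (quot-lift e ρ<d)) (weight-cong (rem-lift e ρ<d)))

  recurrent-lift : ∀ {e ρ} → IsResidue ρ → G.Recurrent e → H.Recurrent (lift e ρ)
  recurrent-lift {e} ρ<d rec = recurrent-from-quot (G.Recurrent-cong (G.≐-sym (quot-lift e ρ<d)) rec)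

  ∼-lift : ∀ {c e ρ} → IsResidue ρ → quot c G.∼ e → rem c H.≐ ρ → c H.∼ lift e ρ
  ∼-lift {e = e} ρ<d q∼e r≐ρ =
    ∼-from-quot (G.∼-cong G.≐-refl (G.≐-sym (quot-lift e ρ<d)) q∼e) (H.≐-trans r≐ρ (H.≐-sym (rem-lift e ρ<d)))

  lift-∼ : ∀ {e e' ρ ρ'} → IsResidue ρ → IsResidue ρ' → lift e ρ H.∼ lift e' ρ' → e G.∼ e' × ρ H.≐ ρ'
  lift-∼ {e} {e'} ρ<d ρ'<d sim =
    let (q∼ , r≐) = ∼-quot sim in
    G.∼-cong (quot-lift e ρ<d) (quot-lift e' ρ'<d) q∼ ,
    H.≐-trans (H.≐-sym (rem-lift e ρ<d)) (H.≐-trans r≐ (rem-lift e' ρ'<d))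

  classDlvl-lift : ∀ {e ρ k} → IsResidue ρ → G.ClassDlvl e k → H.ClassDlvl (lift e ρ) (d * k + weight ρ)
  classDlvl-lift {e} {ρ} {k} ρ<d ((e* , rec* , e∼e* , dlvl≡k) , maximal) =
    (lift e* ρ , recurrent-lift ρ<d rec* ,
     ∼-lift ρ<d (G.∼-cong (G.≐-sym (quot-lift e ρ<d)) G.≐-refl e∼e*) (rem-lift e ρ<d) ,
     trans (dlvl-lift ρ<d) (cong (λ t → d * t + weight ρ) dlvl≡k)) ,
    bound
    where
    bound : ∀ E → H.Recurrent E → lift e ρ H.∼ E → H.dlvl E ≤ d * k + weight ρ
    bound E recE sim = begin
      H.dlvl E                           ≡⟨ dlvl-power E ⟩
      d * G.dlvl (quot E) + weight (rem E) ≤⟨ +-mono-≤ (*-monoʳ-≤ d (maximal (quot E) (recurrent-quot recE) e∼qE))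
                                                        (≤-reflexive (weight-cong (H.≐-sym ρ≐rE))) ⟩
      d * k + weight ρ                   ∎
      where
      open ≤-Reasoning
      e∼qE = G.∼-cong (quot-lift e ρ<d) G.≐-refl (proj₁ (∼-quot sim))
      ρ≐rE = H.≐-trans (H.≐-sym (rem-lift e ρ<d)) (proj₂ (∼-quot sim))

  classDlvl-quot : ∀ {c K} → H.ClassDlvl c K → ∃ λ k → d * k + weight (rem c) ≡ K × G.ClassDlvl (quot c) k
  classDlvl-quot {c} {K} ((E , recE , c∼E , dlvl≡K) , maximal) =
    k , K≡ , (quot E , recurrent-quot recE , proj₁ (∼-quot c∼E) , refl) , bound
    where
    k = G.dlvl (quot E)
    K≡ : d * k + weight (rem c) ≡ K
    K≡ = trans (cong (d * k +_) (weight-cong (proj₂ (∼-quot c∼E)))) (trans (sym (dlvl-power E)) dlvl≡K)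
    bound : ∀ e → G.Recurrent e → quot c G.∼ e → G.dlvl e ≤ k
    bound e rec q∼e = *-cancelˡ-≤ d (+-cancelʳ-≤ (weight (rem c)) _ _
      (subst₂ _≤_ (dlvl-lift (rem-residue c)) (sym K≡)
        (maximal (lift e (rem c)) (recurrent-lift (rem-residue c) rec) (∼-lift (rem-residue c) q∼e H.≐-refl))))

  enum-power-classes : ∀ {b : Poly} → (∀ j → Enumeration (G.RecurrentAtLevel j) G._∼_ (b j))
    → ∀ K → Enumeration (H.RecurrentAtLevel K) H._∼_ ((substPow d b *P (geomP d ^P (n ∸ 1))) K)
  enum-power-classes {b} enG K =
    transversal-map (λ (e , ρ) → lift e ρ) valid reflect reach
      (subst (λ t → Enumeration Pairs (Pointwise G._∼_ H._≐_) ((substPow d b *P (geomP d ^P t)) K)) (falses-≟ s)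
        (enum-*P K (enum-substPow d enG) (enum-residues d (_≟ s)) (Residue-determined d (_≟ s))))
    where
    Pairs = Convolution K (λ i e → ∃ λ k → d * k ≡ i × G.RecurrentAtLevel k e) (Residue d (_≟ s))
    valid : ∀ {eρ} → Pairs eρ → H.RecurrentAtLevel K (lift (proj₁ eρ) (proj₂ eρ))
    valid (_ , _ , i+j≡K , (k , refl , rec , cd) , (ρ<d , refl)) =
      recurrent-lift ρ<d rec , subst (H.ClassDlvl _) i+j≡K (classDlvl-lift ρ<d cd)
    reflect : ∀ {eρ eρ'} → Pairs eρ → Pairs eρ'
      → lift (proj₁ eρ) (proj₂ eρ) H.∼ lift (proj₁ eρ') (proj₂ eρ') → Pointwise G._∼_ H._≐_ eρ eρ'
    reflect (_ , _ , _ , _ , (ρ<d , _)) (_ , _ , _ , _ , (ρ'<d , _)) = lift-∼ ρ<d ρ'<d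
    reach : ∀ {c} → H.RecurrentAtLevel K c → ∃ λ eρ → Pairs eρ
      × (∀ {eρ'} → Pairs eρ' → Pointwise G._∼_ H._≐_ eρ eρ' → c H.∼ lift (proj₁ eρ') (proj₂ eρ'))
    reach {c} (rec , cd) =
      let (k , K≡ , gcd) = classDlvl-quot cd in
      (quot c , rem c) ,
      (d * k , weight (rem c) , K≡ , (k , refl , recurrent-quot rec , gcd) , (rem-residue c , refl)) ,
      λ (_ , _ , _ , _ , (ρ'<d , _)) (q∼ , r≐) → ∼-lift ρ'<d q∼ r≐

lemma5p1 : {n : ℕ} (A : Adj n) (s : Fin n) (d : ℕ)
    → StronglyConnected A → 1 ≤ d
    → (b : Poly) → IsBM A s b
    → IsBM (power d A) s (substPow d b *P (geomP d ^P (n ∸ 1)))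
lemma5p1 A s (suc d-1) _ _ b isBM K =
  H.classCount-from-enumeration (enum-power-classes (λ j → G.enumeration-from-classCount (isBM j)) K)
  where open PowerGraph A s d-1
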